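{- Let $L$ be a countable language and $M,N$ be $L$-structures (of any size). Then $M\equiv_{\infty,\omega}N$ if and only if the canonical flattenings $N^\flat$ and $M^\flat$ are isomorphic as $L^\flat$-structures.
   Context: $M\equiv_{\infty,\omega}N$ means there is a back-and-forth system between $M$ and $N$ (equivalently, $M,N$ satisfy the same $L_{\infty,\omega}$-sentences). For a single structure $M$, a back-and-forth system on $M$ is a nonempty set of pairs $(\bar a,\bar b)$ of equal-length finite tuples from $M$ with $\bar a\mapsto\bar b$ preserving atomic formulas and having the back and forth extension properties; $\mathcal F_\infty=\{(\bar a,\bar b):(M,\bar a)\equiv_{\infty,\omega}(M,\bar b)\}$ and $E_k=\mathcal F_\infty\cap M^{2k}$ is an equivalence relation on $M^k$. $L^\flat$ has unary predicates $U_n$, unary predicates $\alpha_n^\flat$ for quantifier-free $L$-formulas $\alpha(x_0,\dots,x_{n-1})$, and unary functions $P^f_{k,n}$ for injections $f:k\to n$. The canonical flattening $M^\flat$ is the $L^\flat$-structure with universe $\bigsqcup_nM^n/E_n$, $U_n=M^n/E_n$, $\alpha_n^\flat=\{\bar a/E_n:M\models\alpha(\bar a)\}$, $P^f_{k,n}(\bar a/E_n)=(a_{f(0)},\dots,a_{f(k-1)})/E_k$. -}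

module Defs where

open import Level using () renaming (suc to lsuc)
open import Data.Nat using (ℕ; zero; suc; _≟_)
open import Data.Fin using (Fin; zero; suc; fromℕ; inject₁)
open import Data.Vec using (Vec; []; _∷_; _∷ʳ_; lookup; tabulate)
open import Data.Vec.Properties using (lookup∘tabulate)
open import Data.Product using (Σ; _×_; _,_; proj₁; proj₂)
open import Data.Sum using (_⊎_; inj₁; inj₂)
open import Data.Empty using (⊥)
open import Data.Unit using (⊤)
open import Function.Bundles using (_↣_; _⇔_; mk⇔; Equivalence)
open import Function.Definitions using (Injective)
open import Relation.Binary.Structures using (IsEquivalence)
open import Relation.Binary.PropositionalEquality
  using (_≡_; refl; sym; trans; cong; cong₂; subst)
open import Relation.Nullary using (¬_; yes; no)

record Language : Set₁ where
  field
    Func      : Set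
    Rel       : Set
    funArity  : Func → ℕ
    relArity  : Rel → ℕ

open Language public

Countable : Language → Set
Countable L = (Func L ↣ ℕ) × (Rel L ↣ ℕ)

record Structure (L : Language) : Set₁ where
  field
    Carrier : Set
    funI    : (f : Func L) → Vec Carrier (funArity L f) → Carrier
    relI    : (r : Rel L) → Vec Carrier (relArity L r) → Set

open Structure public

module _ (L : Language) where

  data Term (n : ℕ) : Set where
    var : Fin n → Term n
    app : (f : Func L) → Vec (Term n) (funArity L f) → Term n

  data Atomic (n : ℕ) : Set where
    _≐_ : Term n → Term n → Atomic n
    rel : (r : Rel L) → Vec (Term n) (relArity L r) → Atomic n

  data QF (n : ℕ) : Set where
    atom      : Atomic n → QF n
    ⊤ᶠ ⊥ᶠ      : QF n
    ¬ᶠ_        : QF n → QF n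
    _∧ᶠ_ _∨ᶠ_  : QF n → QF n → QF n

module _ {L : Language} (M : Structure L) where

  mutual
    eval : ∀ {n} → Term L n → Vec (Carrier M) n → Carrier M
    eval (var i)    as = lookup as i
    eval (app f ts) as = funI M f (evalVec ts as)

    evalVec : ∀ {n k} → Vec (Term L n) k → Vec (Carrier M) n → Vec (Carrier M) k
    evalVec []       as = []
    evalVec (t ∷ ts) as = eval t as ∷ evalVec ts as

  SatA : ∀ {n} → Atomic L n → Vec (Carrier M) n → Set
  SatA (t ≐ u)    as = eval t as ≡ eval u as
  SatA (rel r ts) as = relI M r (evalVec ts as)

  Sat : ∀ {n} → QF L n → Vec (Carrier M) n → Set
  Sat (atom φ)  as = SatA φ as
  Sat ⊤ᶠ        as = ⊤
  Sat ⊥ᶠ        as = ⊥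
  Sat (¬ᶠ φ)    as = ¬ Sat φ as
  Sat (φ ∧ᶠ ψ)  as = Sat φ as × Sat ψ as
  Sat (φ ∨ᶠ ψ)  as = Sat φ as ⊎ Sat ψ as

module _ {L : Language} (M N : Structure L) where

  TupleRel : Set₁
  TupleRel = ∀ {k} → Vec (Carrier M) k → Vec (Carrier N) k → Set

  record IsBackAndForth (S : TupleRel) : Set where
    field
      nonempty : Σ ℕ λ k → Σ (Vec (Carrier M) k) λ as → Σ (Vec (Carrier N) k) λ bs → S as bs
      atomic   : ∀ {k} {as : Vec (Carrier M) k} {bs : Vec (Carrier N) k} →
                 S as bs → (φ : Atomic L k) → SatA M φ as ⇔ SatA N φ bs
      forth    : ∀ {k} {as : Vec (Carrier M) k} {bs : Vec (Carrier N) k} →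
                 S as bs → (a : Carrier M) → Σ (Carrier N) λ b → S (as ∷ʳ a) (bs ∷ʳ b)
      back     : ∀ {k} {as : Vec (Carrier M) k} {bs : Vec (Carrier N) k} →
                 S as bs → (b : Carrier N) → Σ (Carrier M) λ a → S (as ∷ʳ a) (bs ∷ʳ b)

  _≡∞_ : Set₁
  _≡∞_ = Σ TupleRel IsBackAndForth

  EquivAt : ∀ {k} → Vec (Carrier M) k → Vec (Carrier N) k → Set₁
  EquivAt as bs = Σ TupleRel λ S → IsBackAndForth S × S as bs

open IsBackAndForth

module _ {L : Language} {M N : Structure L} where

  qfPres : ∀ {k} {as : Vec (Carrier M) k} {bs : Vec (Carrier N) k} →
           (∀ φ → SatA M φ as ⇔ SatA N φ bs) → ∀ ψ → Sat M ψ as ⇔ Sat N ψ bs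
  qfPres h (atom φ) = h φ
  qfPres h ⊤ᶠ = mk⇔ (λ x → x) (λ x → x)
  qfPres h ⊥ᶠ = mk⇔ (λ x → x) (λ x → x)
  qfPres h (¬ᶠ ψ) = mk⇔ (λ n s → n (Equivalence.from (qfPres h ψ) s))
                        (λ n s → n (Equivalence.to (qfPres h ψ) s))
  qfPres h (ψ ∧ᶠ χ) = mk⇔ (λ (x , y) → Equivalence.to (qfPres h ψ) x , Equivalence.to (qfPres h χ) y)
                          (λ (x , y) → Equivalence.from (qfPres h ψ) x , Equivalence.from (qfPres h χ) y)
  qfPres h (ψ ∨ᶠ χ) = mk⇔ to′ from′
    where
      to′ : _ → _
      to′ (inj₁ x) = inj₁ (Equivalence.to (qfPres h ψ) x)
      to′ (inj₂ y) = inj₂ (Equivalence.to (qfPres h χ) y)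
      from′ : _ → _
      from′ (inj₁ x) = inj₁ (Equivalence.from (qfPres h ψ) x)
      from′ (inj₂ y) = inj₂ (Equivalence.from (qfPres h χ) y)

  equivAt-sym : ∀ {k} {as : Vec (Carrier M) k} {bs : Vec (Carrier N) k} →
                EquivAt M N as bs → EquivAt N M bs as
  equivAt-sym (S , bf , s) = (λ bs as → S as bs) , record
    { nonempty = let (k , as , bs , p) = nonempty bf in k , bs , as , p
    ; atomic = λ p φ → mk⇔ (Equivalence.from (atomic bf p φ)) (Equivalence.to (atomic bf p φ))
    ; forth = λ p b → back bf p b
    ; back = λ p a → forth bf p a
    } , s

module _ {L : Language} {M : Structure L} where

  equivAt-refl : ∀ {k} (as : Vec (Carrier M) k) → EquivAt M M as as
  equivAt-refl {k} as = (λ xs ys → xs ≡ ys) , record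
    { nonempty = k , as , as , refl
    ; atomic = λ { refl φ → mk⇔ (λ x → x) (λ x → x) }
    ; forth = λ { refl a → a , refl }
    ; back = λ { refl b → b , refl }
    } , refl

module _ {L : Language} {M N K : Structure L} where

  equivAt-trans : ∀ {k} {as : Vec (Carrier M) k} {bs : Vec (Carrier N) k}
                  {cs : Vec (Carrier K) k} →
                  EquivAt M N as bs → EquivAt N K bs cs → EquivAt M K as cs
  equivAt-trans {k} {as} {bs} {cs} (S , bf , s) (T , bf′ , t) =
    (λ xs zs → Σ _ λ ys → S xs ys × T ys zs) , record
    { nonempty = k , as , cs , bs , s , t
    ; atomic = λ (ys , p , q) φ →
        mk⇔ (λ x → Equivalence.to (atomic bf′ q φ) (Equivalence.to (atomic bf p φ) x))
            (λ z → Equivalence.from (atomic bf p φ) (Equivalence.from (atomic bf′ q φ) z))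
    ; forth = λ (ys , p , q) a →
        let (b , p′) = forth bf p a ; (c , q′) = forth bf′ q b in c , _ , p′ , q′
    ; back = λ (ys , p , q) c →
        let (b , q′) = back bf′ q c ; (a , p′) = back bf p b in a , _ , p′ , q′
    } , (bs , s , t)

Pw : ∀ {A : Set} {j m} → Vec A j → Vec A m → (Fin j → Fin m) → Set
Pw cs as g = ∀ i → lookup cs i ≡ lookup as (g i)

module _ {L : Language} where

  mutual
    renameT : ∀ {j m} → (Fin j → Fin m) → Term L j → Term L m
    renameT g (var i)    = var (g i)
    renameT g (app f ts) = app f (renameV g ts)

    renameV : ∀ {j m k} → (Fin j → Fin m) → Vec (Term L j) k → Vec (Term L m) k
    renameV g []       = []
    renameV g (t ∷ ts) = renameT g t ∷ renameV g ts

  renameA : ∀ {j m} → (Fin j → Fin m) → Atomic L j → Atomic L m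
  renameA g (t ≐ u)    = renameT g t ≐ renameT g u
  renameA g (rel r ts) = rel r (renameV g ts)

  module _ (M : Structure L) where
    mutual
      evalRen : ∀ {j m} {cs : Vec (Carrier M) j} {as : Vec (Carrier M) m} {g} →
                Pw cs as g → (t : Term L j) → eval M t cs ≡ eval M (renameT g t) as
      evalRen pw (var i)    = pw i
      evalRen pw (app f ts) = cong (funI M f) (evalRenV pw ts)

      evalRenV : ∀ {j m k} {cs : Vec (Carrier M) j} {as : Vec (Carrier M) m} {g} →
                 Pw cs as g → (ts : Vec (Term L j) k) →
                 evalVec M ts cs ≡ evalVec M (renameV g ts) as
      evalRenV pw []       = refl
      evalRenV pw (t ∷ ts) = cong₂ _∷_ (evalRen pw t) (evalRenV pw ts)

    satRen : ∀ {j m} {cs : Vec (Carrier M) j} {as : Vec (Carrier M) m} {g} →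
             Pw cs as g → (φ : Atomic L j) → SatA M φ cs ⇔ SatA M (renameA g φ) as
    satRen pw (t ≐ u) = mk⇔
      (λ e → trans (sym (evalRen pw t)) (trans e (evalRen pw u)))
      (λ e → trans (evalRen pw t) (trans e (sym (evalRen pw u))))
    satRen pw (rel r ts) = mk⇔
      (subst (relI M r) (evalRenV pw ts))
      (subst (relI M r) (sym (evalRenV pw ts)))

ext : ∀ {j m} → (Fin j → Fin m) → Fin (suc j) → Fin (suc m)
ext {zero}  {m} g zero    = fromℕ m
ext {suc j}     g zero    = inject₁ (g zero)
ext {suc j}     g (suc i) = ext (λ x → g (suc x)) i

lookup-fromℕ : ∀ {A : Set} {m} (as : Vec A m) a → lookup (as ∷ʳ a) (fromℕ m) ≡ a
lookup-fromℕ []       a = refl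
lookup-fromℕ (x ∷ as) a = lookup-fromℕ as a

lookup-inject₁ : ∀ {A : Set} {m} (as : Vec A m) a i → lookup (as ∷ʳ a) (inject₁ i) ≡ lookup as i
lookup-inject₁ (x ∷ as) a zero    = refl
lookup-inject₁ (x ∷ as) a (suc i) = lookup-inject₁ as a i

Pw-ext : ∀ {A : Set} {j m} (cs : Vec A j) (as : Vec A m) (g : Fin j → Fin m) (a : A) →
         Pw {A = A} cs as g → Pw {A = A} (cs ∷ʳ a) (as ∷ʳ a) (ext g)
Pw-ext []       as g a pw zero    = sym (lookup-fromℕ as a)
Pw-ext (c ∷ cs) as g a pw zero    = trans (pw zero) (sym (lookup-inject₁ as a (g zero)))
Pw-ext (c ∷ cs) as g a pw (suc i) = Pw-ext cs as (λ x → g (suc x)) a (λ x → pw (suc x)) i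

module _ {L : Language} {M N : Structure L} where

  equivAt-restrict : ∀ {j m} {as : Vec (Carrier M) m} {bs : Vec (Carrier N) m}
                     {cs : Vec (Carrier M) j} {ds : Vec (Carrier N) j} (g : Fin j → Fin m) →
                     Pw cs as g → Pw ds bs g → EquivAt M N as bs → EquivAt M N cs ds
  equivAt-restrict {j} {m} {as} {bs} {cs} {ds} g pc pd (S , bf , s) =
    T , record
    { nonempty = j , cs , ds , m , as , bs , g , s , pc , pd
    ; atomic = λ (m , as , bs , g , s , pc , pd) φ →
        let e1 = satRen M pc φ ; e2 = atomic bf s (renameA g φ) ; e3 = satRen N pd φ in
        mk⇔ (λ x → Equivalence.from e3 (Equivalence.to e2 (Equivalence.to e1 x)))
            (λ y → Equivalence.from e1 (Equivalence.from e2 (Equivalence.to e3 y)))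
    ; forth = λ { {as = cs} {ds} (m , as , bs , g , s , pc , pd) a →
        let (b , s′) = forth bf s a in
        b , suc m , as ∷ʳ a , bs ∷ʳ b , ext g , s′ , Pw-ext cs as g a pc , Pw-ext ds bs g b pd }
    ; back = λ { {as = cs} {ds} (m , as , bs , g , s , pc , pd) b →
        let (a , s′) = back bf s b in
        a , suc m , as ∷ʳ a , bs ∷ʳ b , ext g , s′ , Pw-ext cs as g a pc , Pw-ext ds bs g b pd }
    } , (m , as , bs , g , s , pc , pd)
    where
      T : TupleRel M N
      T {k} xs ys = Σ ℕ λ m → Σ (Vec (Carrier M) m) λ as → Σ (Vec (Carrier N) m) λ bs →
                    Σ (Fin k → Fin m) λ g → S as bs × Pw xs as g × Pw ys bs g

-- Setoid-based structures (used for quotient structures such as M♭)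
-- and isomorphisms between them.

record SetoidStructure (L : Language) : Set₂ where
  field
    Carrier       : Set
    _≈_           : Carrier → Carrier → Set₁
    isEquivalence : IsEquivalence _≈_
    funI          : (f : Func L) → Vec Carrier (funArity L f) → Carrier
    relI          : (r : Rel L) → Vec Carrier (relArity L r) → Set
    funI-cong     : ∀ f {u v} → (∀ i → lookup u i ≈ lookup v i) → funI f u ≈ funI f v
    relI-cong     : ∀ r {u v} → (∀ i → lookup u i ≈ lookup v i) → relI r u → relI r v

record Iso {L : Language} (A B : SetoidStructure L) : Set₁ where
  private
    module A = SetoidStructure A
    module B = SetoidStructure B
  field
    to        : A.Carrier → B.Carrier
    from      : B.Carrier → A.Carrier
    to-cong   : ∀ {x y} → x A.≈ y → to x B.≈ to y
    from-cong : ∀ {x y} → x B.≈ y → from x A.≈ from y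
    from∘to   : ∀ x → from (to x) A.≈ x
    to∘from   : ∀ y → to (from y) B.≈ y
    to-fun    : ∀ f (v : Vec A.Carrier (funArity L f)) →
                to (A.funI f v) B.≈ B.funI f (Data.Vec.map to v)
    to-rel    : ∀ r (v : Vec A.Carrier (relArity L r)) →
                A.relI r v ⇔ B.relI r (Data.Vec.map to v)

_≅_ : {L : Language} → SetoidStructure L → SetoidStructure L → Set₁
A ≅ B = Iso A B

Injection : ℕ → ℕ → Set
Injection k n = Σ (Fin k → Fin n) (Injective _≡_ _≡_)

_♭ : Language → Language
L ♭ = record
  { Func     = Σ ℕ λ k → Σ ℕ λ n → Injection k n
  ; Rel      = ℕ ⊎ (Σ ℕ λ n → QF L n)                      -- U_n , α_n^♭
  ; funArity = λ _ → 1
  ; relArity = λ _ → 1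
  }

-- The canonical flattening M♭: universe ⨆ₙ Mⁿ/Eₙ, presented as the
-- setoid of pairs (n , ā) modulo Eₙ.

module Flat {L : Language} (M : Structure L) where

  Car : Set
  Car = Σ ℕ λ n → Vec (Carrier M) n

  data _≈♭_ : Car → Car → Set₁ where
    eq : ∀ {n} {as bs : Vec (Carrier M) n} → EquivAt M M as bs → (n , as) ≈♭ (n , bs)

  ≈♭-isEquivalence : IsEquivalence _≈♭_
  ≈♭-isEquivalence = record
    { refl  = λ { {n , as} → eq (equivAt-refl as) }
    ; sym   = λ { (eq p) → eq (equivAt-sym p) }
    ; trans = λ { (eq p) (eq q) → eq (equivAt-trans p q) }
    }

  -- P^f_{k,n}(ā/Eₙ) = (a_{f(0)},…,a_{f(k-1)})/E_k ; identity outside U_n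
  P : ∀ k n → (Fin k → Fin n) → Car → Car
  P k n f (m , as) with m ≟ n
  ... | yes refl = k , tabulate (λ i → lookup as (f i))
  ... | no _     = m , as

  P-cong : ∀ k n f {x y} → x ≈♭ y → P k n f x ≈♭ P k n f y
  P-cong k n f (eq {m} {as} {bs} p) with m ≟ n
  ... | yes refl = eq (equivAt-restrict f
                         (λ i → lookup∘tabulate (λ i → lookup as (f i)) i)
                         (λ i → lookup∘tabulate (λ i → lookup bs (f i)) i) p)
  ... | no _     = eq p

  data Holds♭ (n : ℕ) (α : QF L n) : Car → Set where
    holds : ∀ {as} → Sat M α as → Holds♭ n α (n , as)

  fun♭ : (f : Func (L ♭)) → Vec Car 1 → Car
  fun♭ (k , n , f , _) (x ∷ []) = P k n f x

  rel♭ : (r : Rel (L ♭)) → Vec Car 1 → Set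
  rel♭ (inj₁ n)       (x ∷ []) = proj₁ x ≡ n
  rel♭ (inj₂ (n , α)) (x ∷ []) = Holds♭ n α x

  fun♭-cong : ∀ f {u v} → (∀ i → lookup u i ≈♭ lookup v i) → fun♭ f u ≈♭ fun♭ f v
  fun♭-cong (k , n , f , _) {x ∷ []} {y ∷ []} pw = P-cong k n f (pw zero)

  rel♭-cong : ∀ r {u v} → (∀ i → lookup u i ≈♭ lookup v i) → rel♭ r u → rel♭ r v
  rel♭-cong (inj₁ n) {x ∷ []} {y ∷ []} pw h with pw zero
  ... | eq _ = h
  rel♭-cong (inj₂ (n , α)) {x ∷ []} {y ∷ []} pw (holds h) with pw zero
  ... | eq (S , bf , s) = holds (Equivalence.to (qfPres (atomic bf s) α) h)

  flat : SetoidStructure (L ♭)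
  flat = record
    { Carrier = Car
    ; _≈_ = _≈♭_
    ; isEquivalence = ≈♭-isEquivalence
    ; funI = fun♭
    ; relI = rel♭
    ; funI-cong = fun♭-cong
    ; relI-cong = rel♭-cong
    }

_♭ˢ : {L : Language} → Structure L → SetoidStructure (L ♭)
M ♭ˢ = Flat.flat M

-- (⇒) A back-and-forth system makes the empty tuples of M and N
-- ∞-equivalent, so every tuple of M has an ∞-equivalent partner tuple in
-- N and vice versa; sending ā/Eₙ to the class of its partner is an
-- isomorphism of flattenings.
-- (⇐) An isomorphism of flattenings preserves the predicates Uₙ, α♭ₙ and
-- commutes with the projection P forgetting the last coordinate.  Hence
-- "the isomorphism sends ā/Eₖ to b̄/Eₖ" holds for the empty tuples, is
-- preserved under extending ā by one element (split the image of āa into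
-- c̄c, note c̄ Eₖ b̄, and extend b̄ by the partner of c), and forces ā, b̄ to
-- satisfy the same quantifier-free formulas: a back-and-forth system.
module Submission where

open import Level using (0ℓ) renaming (suc to lsuc)
open import Data.Nat using (ℕ; zero; suc; _≟_)
open import Data.Fin using (Fin; inject₁)
open import Data.Fin.Properties using (inject₁-injective)
open import Data.Vec using (Vec; []; _∷_; _∷ʳ_; lookup; tabulate; map; initLast)
open import Data.Vec.Properties
  using (lookup∘tabulate; tabulate∘lookup; tabulate-cong; lookup-map)
open import Data.Product using (Σ; _×_; _,_; proj₁; proj₂)
open import Data.Sum using (_⊎_; inj₁; inj₂)
open import Data.Empty using (⊥-elim)
open import Function using (_∘_)
open import Function.Bundles using (_⇔_; mk⇔; Equivalence)
open import Relation.Binary.Bundles using (Setoid)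
open import Relation.Binary.Structures using (IsEquivalence)
open import Relation.Binary.PropositionalEquality using (_≡_; refl; sym; trans; cong)
open import Relation.Nullary using (yes; no)
import Relation.Binary.Reasoning.Setoid as SetoidReasoning
open import Defs
open IsBackAndForth

module _ {L : Language} {M N : Structure L} where

  ≡∞⇒equivAt-[] : M ≡∞ N → EquivAt M N [] []
  ≡∞⇒equivAt-[] (S , bf) =
    let (_ , _ , _ , s) = nonempty bf in equivAt-restrict (λ ()) (λ ()) (λ ()) (S , bf , s)

  equivAt-forth : ∀ {k} {as : Vec (Carrier M) k} {bs : Vec (Carrier N) k} →
                  EquivAt M N as bs → ∀ a →
                  Σ (Carrier N) λ b → EquivAt M N (as ∷ʳ a) (bs ∷ʳ b)
  equivAt-forth (S , bf , s) a = let (b , s′) = forth bf s a in b , S , bf , s′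

  equivAt-select : ∀ {k n} (f : Fin k → Fin n)
                   {as : Vec (Carrier M) n} {bs : Vec (Carrier N) n} →
                   EquivAt M N as bs →
                   EquivAt M N (tabulate (lookup as ∘ f)) (tabulate (lookup bs ∘ f))
  equivAt-select f {as} {bs} =
    equivAt-restrict f (lookup∘tabulate (lookup as ∘ f)) (lookup∘tabulate (lookup bs ∘ f))

  equivAt-sat : ∀ {k} {as : Vec (Carrier M) k} {bs : Vec (Carrier N) k} →
                EquivAt M N as bs → ∀ ψ → Sat M ψ as ⇔ Sat N ψ bs
  equivAt-sat (_ , bf , s) = qfPres (atomic bf s)

  equivAt-bridge : ∀ {k} {as as′ : Vec (Carrier M) k} {bs bs′ : Vec (Carrier N) k} →
                   EquivAt M N as bs → EquivAt M N as′ bs′ →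
                   EquivAt M M as as′ → EquivAt N N bs bs′
  equivAt-bridge p q r = equivAt-trans (equivAt-sym p) (equivAt-trans r q)

  partner : EquivAt M N [] [] → ∀ {n} (as : Vec (Carrier M) n) →
            Σ (Vec (Carrier N) n) (EquivAt M N as)
  partner e {zero} [] = [] , e
  partner e {suc n} as with initLast as
  ... | xs , x , refl =
    let (ys , p) = partner e xs ; (y , q) = equivAt-forth p x in ys ∷ʳ y , q

setoidOf : {L : Language} → SetoidStructure L → Setoid 0ℓ (lsuc 0ℓ)
setoidOf A = record { isEquivalence = SetoidStructure.isEquivalence A }

module _ {L : Language} {A B : SetoidStructure L} where
  private
    module A = SetoidStructure A
    module B = SetoidStructure B
    module Aᵉ = IsEquivalence A.isEquivalence
    module Bᵉ = IsEquivalence B.isEquivalence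

  to≈⇒from≈ : (I : A ≅ B) → ∀ {x y} → Iso.to I x B.≈ y → Iso.from I y A.≈ x
  to≈⇒from≈ I p = Aᵉ.trans (Iso.from-cong I (Bᵉ.sym p)) (Iso.from∘to I _)

  ≅-sym : A ≅ B → B ≅ A
  ≅-sym I = record
    { to = from ; from = to
    ; to-cong = from-cong ; from-cong = to-cong
    ; from∘to = to∘from ; to∘from = from∘to
    ; to-fun = from-fun ; to-rel = from-rel
    }
    where
      open Iso I
      open SetoidReasoning (setoidOf A)

      to∘from-lookup : ∀ {n} (v : Vec B.Carrier n) i →
                       lookup (map to (map from v)) i B.≈ lookup v i
      to∘from-lookup v i = Bᵉ.trans
        (Bᵉ.reflexive (trans
           (lookup-map i to (map from v)) (cong to (lookup-map i from v))))
        (to∘from (lookup v i))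

      from-fun : ∀ f (v : Vec B.Carrier (funArity L f)) →
                 from (B.funI f v) A.≈ A.funI f (map from v)
      from-fun f v = begin
        from (B.funI f v)
          ≈⟨ from-cong (B.funI-cong f (Bᵉ.sym ∘ to∘from-lookup v)) ⟩
        from (B.funI f (map to (map from v)))
          ≈⟨ from-cong (Bᵉ.sym (to-fun f (map from v))) ⟩
        from (to (A.funI f (map from v)))
          ≈⟨ from∘to _ ⟩
        A.funI f (map from v)
          ∎

      from-rel : ∀ r (v : Vec B.Carrier (relArity L r)) →
                 B.relI r v ⇔ A.relI r (map from v)
      from-rel r v = mk⇔
        (Equivalence.from (to-rel r (map from v)) ∘ B.relI-cong r (Bᵉ.sym ∘ to∘from-lookup v))
        (B.relI-cong r (to∘from-lookup v) ∘ Equivalence.to (to-rel r (map from v)))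

module Flat-Properties {L : Language} (X : Structure L) where
  open Flat X

  Car-ofLength : ∀ {n} (x : Car) → proj₁ x ≡ n →
                 Σ (Vec (Carrier X) n) λ as → x ≡ (n , as)
  Car-ofLength (_ , as) refl = as , refl

  ≈♭⇒equivAt : ∀ {k} {as bs : Vec (Carrier X) k} →
               (k , as) ≈♭ (k , bs) → EquivAt X X as bs
  ≈♭⇒equivAt (eq p) = p

  P-inject₁-∷ʳ : ∀ {k} (as : Vec (Carrier X) k) a →
                 P k (suc k) inject₁ (suc k , as ∷ʳ a) ≡ (k , as)
  P-inject₁-∷ʳ {k} as a with suc k ≟ suc k
  ... | yes refl = cong (k ,_) (trans
                     (tabulate-cong (lookup-inject₁ as a)) (tabulate∘lookup as))
  ... | no k≢k   = ⊥-elim (k≢k refl)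

  holds-cong : ∀ {n α x y} → x ≈♭ y → Holds♭ n α x → Holds♭ n α y
  holds-cong {α = α} (eq p) (holds h) = holds (Equivalence.to (equivAt-sat p α) h)

  holds⁻¹ : ∀ {n α} {as : Vec (Carrier X) n} → Holds♭ n α (n , as) → Sat X α as
  holds⁻¹ (holds h) = h

module _ {L : Language} {M N : Structure L} (e : EquivAt M N [] []) where
  private
    τ : ∀ {n} → Vec (Carrier M) n → Vec (Carrier N) n
    τ as = proj₁ (partner e as)

    τ-equiv : ∀ {n} (as : Vec (Carrier M) n) → EquivAt M N as (τ as)
    τ-equiv as = proj₂ (partner e as)

    σ : ∀ {n} → Vec (Carrier N) n → Vec (Carrier M) n
    σ bs = proj₁ (partner (equivAt-sym e) bs)

    σ-equiv : ∀ {n} (bs : Vec (Carrier N) n) → EquivAt N M bs (σ bs)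
    σ-equiv bs = proj₂ (partner (equivAt-sym e) bs)

    module M♭ = Flat M
    module N♭ = Flat N

    to : M♭.Car → N♭.Car
    to (n , as) = n , τ as

    from : N♭.Car → M♭.Car
    from (n , bs) = n , σ bs

    to-fun : ∀ f (v : Vec M♭.Car 1) → to (M♭.fun♭ f v) N♭.≈♭ N♭.fun♭ f (map to v)
    to-fun (k , n , f , _) ((m , as) ∷ []) with m ≟ n
    ... | yes refl =
      N♭.eq (equivAt-bridge (τ-equiv _) (equivAt-select f (τ-equiv as)) (equivAt-refl _))
    ... | no _     = N♭.eq (equivAt-refl _)

    to-holds : ∀ {n α} (x : M♭.Car) → M♭.Holds♭ n α x → N♭.Holds♭ n α (to x)
    to-holds {α = α} _ (M♭.holds {as} h) =
      N♭.holds (Equivalence.to (equivAt-sat (τ-equiv as) α) h)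

    from-holds : ∀ {n α} (x : M♭.Car) → N♭.Holds♭ n α (to x) → M♭.Holds♭ n α x
    from-holds {α = α} (_ , as) (N♭.holds h) =
      M♭.holds (Equivalence.from (equivAt-sat (τ-equiv as) α) h)

    to-rel : ∀ r (v : Vec M♭.Car 1) → M♭.rel♭ r v ⇔ N♭.rel♭ r (map to v)
    to-rel (inj₁ n) (x ∷ []) = mk⇔ (λ h → h) (λ h → h)
    to-rel (inj₂ _) (x ∷ []) = mk⇔ (to-holds x) (from-holds x)

  equivAt-[]⇒flat≅ : (M ♭ˢ) ≅ (N ♭ˢ)
  equivAt-[]⇒flat≅ = record
    { to = to ; from = from
    ; to-cong = λ { (M♭.eq p) → N♭.eq (equivAt-bridge (τ-equiv _) (τ-equiv _) p) }
    ; from-cong = λ { (N♭.eq p) → M♭.eq (equivAt-bridge (σ-equiv _) (σ-equiv _) p) }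
    ; from∘to = λ (_ , as) →
        M♭.eq (equivAt-bridge (σ-equiv (τ as)) (equivAt-sym (τ-equiv as)) (equivAt-refl _))
    ; to∘from = λ (_ , bs) →
        N♭.eq (equivAt-bridge (τ-equiv (σ bs)) (equivAt-sym (σ-equiv bs)) (equivAt-refl _))
    ; to-fun = to-fun ; to-rel = to-rel
    }

module Flat-Iso {L : Language} {X Y : Structure L} (I : (X ♭ˢ) ≅ (Y ♭ˢ)) where
  open Iso I
  private
    module X♭ = Flat X
    module Y♭ = Flat Y
    module Xᵖ = Flat-Properties X
    module Yᵖ = Flat-Properties Y
    module Yᵉ = IsEquivalence Y♭.≈♭-isEquivalence

  to-length : ∀ x → proj₁ (to x) ≡ proj₁ x
  to-length x = Equivalence.to (to-rel (inj₁ (proj₁ x)) (x ∷ [])) refl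

  to-dropLast : ∀ k x → to (X♭.P k (suc k) inject₁ x) Y♭.≈♭ Y♭.P k (suc k) inject₁ (to x)
  to-dropLast k x = to-fun (k , suc k , inject₁ , inject₁-injective) (x ∷ [])

  to-[] : to (0 , []) Y♭.≈♭ (0 , [])
  to-[] with Yᵖ.Car-ofLength (to (0 , [])) (to-length _)
  ... | [] , to[]≡[] = Yᵉ.reflexive to[]≡[]

  to-sat : ∀ {k} {as : Vec (Carrier X) k} {bs : Vec (Carrier Y) k} →
           to (k , as) Y♭.≈♭ (k , bs) → ∀ ψ → Sat X ψ as ⇔ Sat Y ψ bs
  to-sat {k} {as} p ψ = mk⇔
    (Yᵖ.holds⁻¹ ∘ Yᵖ.holds-cong p ∘ Equivalence.to ψ♭ ∘ X♭.holds)
    (Xᵖ.holds⁻¹ ∘ Equivalence.from ψ♭ ∘ Yᵖ.holds-cong (Yᵉ.sym p) ∘ Y♭.holds)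
    where
      ψ♭ : X♭.Holds♭ k ψ (k , as) ⇔ Y♭.Holds♭ k ψ (to (k , as))
      ψ♭ = to-rel (inj₂ (k , ψ)) ((k , as) ∷ [])

  to-extend : ∀ {k} {as : Vec (Carrier X) k} {bs : Vec (Carrier Y) k} →
              to (k , as) Y♭.≈♭ (k , bs) → ∀ a →
              Σ (Carrier Y) λ b → to (suc k , as ∷ʳ a) Y♭.≈♭ (suc k , bs ∷ʳ b)
  to-extend {k} {as} {bs} p a with Yᵖ.Car-ofLength (to (suc k , as ∷ʳ a)) (to-length _)
  ... | cs , to-as∷ʳa≡cs with initLast cs
  ... | ys , y , refl =
    let (b , ys∷ʳy~bs∷ʳb) = equivAt-forth (Yᵖ.≈♭⇒equivAt ys≈bs) y in
    b , Yᵉ.trans (Yᵉ.reflexive to-as∷ʳa≡cs) (Y♭.eq ys∷ʳy~bs∷ʳb)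
    where
      open SetoidReasoning (setoidOf (Y ♭ˢ))

      ys≈bs : (k , ys) Y♭.≈♭ (k , bs)
      ys≈bs = begin
        (k , ys)                                      ≡⟨ Yᵖ.P-inject₁-∷ʳ ys y ⟨
        Y♭.P k (suc k) inject₁ (suc k , ys ∷ʳ y)      ≡⟨ cong (Y♭.P k (suc k) inject₁) to-as∷ʳa≡cs ⟨
        Y♭.P k (suc k) inject₁ (to (suc k , as ∷ʳ a)) ≈⟨ to-dropLast k _ ⟨
        to (X♭.P k (suc k) inject₁ (suc k , as ∷ʳ a)) ≡⟨ cong to (Xᵖ.P-inject₁-∷ʳ as a) ⟩
        to (k , as)                                   ≈⟨ p ⟩
        (k , bs)                                      ∎

module _ {L : Language} {M N : Structure L}
  (Inv : ∀ {k} → Vec (Carrier M) k → Vec (Carrier N) k → Set₁)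
  (inv-[] : Inv [] [])
  (inv-forth : ∀ {k} {as : Vec (Carrier M) k} {bs} → Inv as bs →
               ∀ a → Σ (Carrier N) λ b → Inv (as ∷ʳ a) (bs ∷ʳ b))
  (inv-back : ∀ {k} {as : Vec (Carrier M) k} {bs} → Inv as bs →
              ∀ b → Σ (Carrier M) λ a → Inv (as ∷ʳ a) (bs ∷ʳ b))
  (inv-atomic : ∀ {k} {as : Vec (Carrier M) k} {bs} → Inv as bs →
                ∀ φ → SatA M φ as ⇔ SatA N φ bs)
  where
  private
    Position : ℕ → Set₁
    Position k = Σ (Vec (Carrier M) k) λ as → Σ (Vec (Carrier N) k) (Inv as)

    respond : ∀ {k} → Position k → Carrier M ⊎ Carrier N → Position (suc k)
    respond (as , bs , i) (inj₁ a) = let (b , i′) = inv-forth i a in as ∷ʳ a , bs ∷ʳ b , i′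
    respond (as , bs , i) (inj₂ b) = let (a , i′) = inv-back i b in as ∷ʳ a , bs ∷ʳ b , i′

    play : ∀ {k} → Vec (Carrier M ⊎ Carrier N) k → Position k
    play []       = [] , [] , inv-[]
    play (m ∷ ms) = respond (play ms) m

    -- Inv is Set₁-valued, so it cannot itself be a TupleRel; instead take the
    -- pairs reached by answering moves with the responses fixed above.
    Reachable : TupleRel M N
    Reachable as bs = Σ _ λ ms → proj₁ (play ms) ≡ as × proj₁ (proj₂ (play ms)) ≡ bs

  ≡∞-fromLargeSystem : M ≡∞ N
  ≡∞-fromLargeSystem = Reachable , record
    { nonempty = 0 , [] , [] , [] , refl , refl
    ; atomic = λ { (ms , refl , refl) → inv-atomic (proj₂ (proj₂ (play ms))) }
    ; forth = λ { (ms , refl , refl) a → _ , inj₁ a ∷ ms , refl , refl }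
    ; back = λ { (ms , refl , refl) b → _ , inj₂ b ∷ ms , refl , refl }
    }

module _ {L : Language} {M N : Structure L} where

  ≡∞⇒flat≅ : M ≡∞ N → (M ♭ˢ) ≅ (N ♭ˢ)
  ≡∞⇒flat≅ = equivAt-[]⇒flat≅ ∘ ≡∞⇒equivAt-[]

  flat≅⇒≡∞ : (M ♭ˢ) ≅ (N ♭ˢ) → M ≡∞ N
  flat≅⇒≡∞ I = ≡∞-fromLargeSystem Inv I.to-[] I.to-extend inv-back
                 (λ p φ → I.to-sat p (atom φ))
    where
      module I = Flat-Iso I
      module I⁻¹ = Flat-Iso (≅-sym I)

      Inv : ∀ {k} → Vec (Carrier M) k → Vec (Carrier N) k → Set₁
      Inv {k} as bs = Flat._≈♭_ N (Iso.to I (k , as)) (k , bs)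

      inv-back : ∀ {k} {as : Vec (Carrier M) k} {bs} → Inv as bs →
                 ∀ b → Σ (Carrier M) λ a → Inv (as ∷ʳ a) (bs ∷ʳ b)
      inv-back p b =
        let (a , q) = I⁻¹.to-extend (to≈⇒from≈ I p) b in a , to≈⇒from≈ (≅-sym I) q

corollary3p27 : (L : Language) → Countable L → (M N : Structure L) →
    (M ≡∞ N) ⇔ ((N ♭ˢ) ≅ (M ♭ˢ))
corollary3p27 L _ M N = mk⇔ (≅-sym ∘ ≡∞⇒flat≅) (flat≅⇒≡∞ ∘ ≅-sym)
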